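{- For every integer $\gamma\ge0$, the vector space $\mathcal{F}_\gamma$ of $\gamma$-edge valued binary trees, endowed with the operations $\hookleftarrow_a,\hookrightarrow_a$ ($a\in[\gamma]$) defined below, is the free $\gamma$-multiplicial algebra over one generator, the generator being the tree with one internal node: $\mathcal{F}_\gamma$ is a $\gamma$-multiplicial algebra, and for every $\gamma$-multiplicial algebra $A$ and every $e\in A$ there is a unique linear map $\mathcal{F}_\gamma\to A$ commuting with all the operations and sending the one-node tree to $e$.
   Context: $\mathbb{K}$ is a field of characteristic zero, $[n]=\{1,\dots,n\}$, $a\downarrow a'=\min(a,a')$, with $a\downarrow\infty=a=\infty\downarrow a$. A $\gamma$-multiplicial algebra is a vector space with bilinear operations $\hookleftarrow_a,\hookrightarrow_a$, $a\in[\gamma]$, such that for all $x,y,z$ and $a,a'\in[\gamma]$: $(x\hookrightarrow_{a'}y)\hookleftarrow_a z=x\hookrightarrow_{a'}(y\hookleftarrow_a z)$; $(x\hookleftarrow_{a'}y)\hookleftarrow_a z=x\hookleftarrow_{a\downarrow a'}(y\hookleftarrow_a z)$; $(x\hookrightarrow_a y)\hookrightarrow_{a\downarrow a'}z=x\hookrightarrow_a(y\hookrightarrow_{a'}z)$. A $\gamma$-edge valued binary tree is a planar binary tree with at least one internal node in which every edge joining two internal nodes is labeled by an element of $[\gamma]$; edges from an internal node to a leaf are regarded as labeled $\infty$. $\mathcal{F}_\gamma$ has basis these trees. Write $\ell$ for the leaf and $N(x,t_1;y,t_2)$ for the tree whose root has left subtree $t_1$ via an edge labeled $x$ and right subtree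 $t_2$ via an edge labeled $y$. Operations (bilinear, recursive): for a tree $s$, $s\hookleftarrow_a\ell:=s$, $\ell\hookrightarrow_a s:=s$, $\ell\hookleftarrow_a s:=0$, $s\hookrightarrow_a\ell:=0$; for $t=N(x,t_1;y,t_2)$, $t\hookleftarrow_a s:=N(x,t_1;a\downarrow y,t_2\hookleftarrow_a s)$ and $s\hookrightarrow_a t:=N(a\downarrow x,s\hookrightarrow_a t_1;y,t_2)$. -}

module Defs where

open import Level using (Level; _⊔_) renaming (suc to lsuc)
open import Algebra.Core using (Op₁; Op₂)
open import Algebra.Bundles using (CommutativeRing)
open import Algebra.Module.Bundles using (Module)
open import Data.Nat using (ℕ; zero; suc; _≤ᵇ_)
open import Data.Fin using (Fin; toℕ)
open import Data.Fin.Properties using (_≟_)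
open import Data.Bool using (Bool; true; false; if_then_else_; _∧_)
open import Data.List using (List; []; _∷_; map; concatMap; _++_)
open import Data.Product using (Σ; _×_; _,_)
open import Relation.Nullary using (¬_; does)
open import Relation.Binary.Core using (Rel)

record Field c ℓ : Set (lsuc (c ⊔ ℓ)) where
  field
    commutativeRing : CommutativeRing c ℓ
  open CommutativeRing commutativeRing public
  field
    0≉1     : ¬ (0# ≈ 1#)
    inverse : ∀ x → ¬ (x ≈ 0#) → Σ Carrier λ y → (x * y) ≈ 1#

  natCast : ℕ → Carrier
  natCast zero    = 0#
  natCast (suc n) = 1# + natCast n

CharacteristicZero : ∀ {c ℓ} → Field c ℓ → Set ℓ
CharacteristicZero K = ∀ n → ¬ (natCast (suc n) ≈ 0#)
  where open Field K

_↓_ : ∀ {γ} → Fin γ → Fin γ → Fin γ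
a ↓ a' = if toℕ a ≤ᵇ toℕ a' then a else a'

-- γ-multiplicial algebras over a commutative ring R.
-- ↩ a x y stands for x ↩_a y, and ↪ a x y for x ↪_a y.

module _ {c ℓ} (R : CommutativeRing c ℓ) where
  open CommutativeRing R using () renaming (Carrier to K)

  record IsMultiplicial {m ℓm} {M : Set m} (_≈ᴹ_ : Rel M ℓm)
           (_+ᴹ_ : Op₂ M) (_*ₗ_ : K → M → M) (γ : ℕ)
           (↩ ↪ : Fin γ → Op₂ M) : Set (c ⊔ m ⊔ ℓm) where
    field
      ↩-cong   : ∀ a {x x' y y'} → x ≈ᴹ x' → y ≈ᴹ y' → ↩ a x y ≈ᴹ ↩ a x' y'
      ↪-cong   : ∀ a {x x' y y'} → x ≈ᴹ x' → y ≈ᴹ y' → ↪ a x y ≈ᴹ ↪ a x' y'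
      ↩-distribʳ : ∀ a x x' y → ↩ a (x +ᴹ x') y ≈ᴹ (↩ a x y +ᴹ ↩ a x' y)
      ↩-distribˡ : ∀ a x y y' → ↩ a x (y +ᴹ y') ≈ᴹ (↩ a x y +ᴹ ↩ a x y')
      ↪-distribʳ : ∀ a x x' y → ↪ a (x +ᴹ x') y ≈ᴹ (↪ a x y +ᴹ ↪ a x' y)
      ↪-distribˡ : ∀ a x y y' → ↪ a x (y +ᴹ y') ≈ᴹ (↪ a x y +ᴹ ↪ a x y')
      ↩-scaleˡ : ∀ a k x y → ↩ a (k *ₗ x) y ≈ᴹ (k *ₗ ↩ a x y)
      ↩-scaleʳ : ∀ a k x y → ↩ a x (k *ₗ y) ≈ᴹ (k *ₗ ↩ a x y)
      ↪-scaleˡ : ∀ a k x y → ↪ a (k *ₗ x) y ≈ᴹ (k *ₗ ↪ a x y)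
      ↪-scaleʳ : ∀ a k x y → ↪ a x (k *ₗ y) ≈ᴹ (k *ₗ ↪ a x y)
      rel₁ : ∀ a a' x y z → ↩ a (↪ a' x y) z ≈ᴹ ↪ a' x (↩ a y z)
      rel₂ : ∀ a a' x y z → ↩ a (↩ a' x y) z ≈ᴹ ↩ (a ↓ a') x (↩ a y z)
      rel₃ : ∀ a a' x y z → ↪ (a ↓ a') (↪ a x y) z ≈ᴹ ↪ a x (↪ a' y z)

  record MultiplicialAlgebra (γ : ℕ) m ℓm : Set (c ⊔ ℓ ⊔ lsuc (m ⊔ ℓm)) where
    field
      module′ : Module R m ℓm
    open Module module′ public
    field
      ↩ ↪ : Fin γ → Op₂ Carrierᴹ
      isMultiplicial : IsMultiplicial _≈ᴹ_ _+ᴹ_ _*ₗ_ γ ↩ ↪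

-- A child of an internal node is either a leaf (edge labelled ∞) or an
-- internal node reached through an edge labelled by an element of [γ].

mutual
  data Tree (γ : ℕ) : Set where
    node : Child γ → Child γ → Tree γ

  data Child (γ : ℕ) : Set where
    leaf  : Child γ
    sub   : Fin γ → Tree γ → Child γ

mutual
  _==ᵀ_ : ∀ {γ} → Tree γ → Tree γ → Bool
  node l r ==ᵀ node l' r' = (l ==ᶜ l') ∧ (r ==ᶜ r')

  _==ᶜ_ : ∀ {γ} → Child γ → Child γ → Bool
  leaf    ==ᶜ leaf      = true
  leaf    ==ᶜ sub _ _   = false
  sub _ _ ==ᶜ leaf      = false
  sub a t ==ᶜ sub a' t' = does (a ≟ a') ∧ (t ==ᵀ t')

Y : ∀ {γ} → Tree γ
Y = node leaf leaf

mutual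
  graftR : ∀ {γ} → Fin γ → Tree γ → Tree γ → Tree γ
  graftR a (node l r) s = node l (graftRᶜ a r s)

  graftRᶜ : ∀ {γ} → Fin γ → Child γ → Tree γ → Child γ
  graftRᶜ a leaf       s = sub a s
  graftRᶜ a (sub y t₂) s = sub (a ↓ y) (graftR a t₂ s)

mutual
  graftL : ∀ {γ} → Fin γ → Tree γ → Tree γ → Tree γ
  graftL a s (node l r) = node (graftLᶜ a s l) r

  graftLᶜ : ∀ {γ} → Fin γ → Tree γ → Child γ → Child γ
  graftLᶜ a s leaf       = sub a s
  graftLᶜ a s (sub x t₁) = sub (a ↓ x) (graftL a s t₁)

-- The vector space F_γ with basis the γ-edge valued binary trees:
-- elements are formal linear combinations (lists of coefficient/tree
-- pairs), two combinations being equal iff every tree has the same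
-- total coefficient in both.

module FreeConstruction {c ℓ} (R : CommutativeRing c ℓ) (γ : ℕ) where
  open CommutativeRing R

  F : Set c
  F = List (Carrier × Tree γ)

  coeff : Tree γ → F → Carrier
  coeff t []            = 0#
  coeff t ((k , s) ∷ u) = (if t ==ᵀ s then k else 0#) + coeff t u

  _≈F_ : Rel F ℓ
  u ≈F v = ∀ t → coeff t u ≈ coeff t v

  _+F_ : Op₂ F
  _+F_ = _++_

  0F : F
  0F = []

  -F_ : Op₁ F
  -F u = map (λ { (k , t) → (- k , t) }) u

  _*ₗF_ : Carrier → F → F
  k *ₗF u = map (λ { (k' , t) → (k * k' , t) }) u

  _*ᵣF_ : F → Carrier → F
  u *ᵣF k = k *ₗF u

  bilin : (Tree γ → Tree γ → Tree γ) → Op₂ F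
  bilin op u v = concatMap (λ { (k , t) → map (λ { (k' , s) → (k * k' , op t s) }) v }) u

  ↩F : Fin γ → Op₂ F
  ↩F a = bilin (graftR a)

  ↪F : Fin γ → Op₂ F
  ↪F a = bilin (graftL a)

  gen : F
  gen = (1# , Y) ∷ []

  record IsMultHom {m ℓm} (A : MultiplicialAlgebra R γ m ℓm)
                   (f : F → MultiplicialAlgebra.Carrierᴹ A) : Set (c ⊔ ℓ ⊔ ℓm) where
    open MultiplicialAlgebra A
    field
      f-cong  : ∀ {u v} → u ≈F v → f u ≈ᴹ f v
      f-+     : ∀ u v → f (u +F v) ≈ᴹ (f u +ᴹ f v)
      f-*ₗ    : ∀ k u → f (k *ₗF u) ≈ᴹ (k *ₗ f u)
      f-↩     : ∀ a u v → f (↩F a u v) ≈ᴹ ↩ a (f u) (f v)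
      f-↪     : ∀ a u v → f (↪F a u v) ≈ᴹ ↪ a (f u) (f v)

-- F_γ is spanned by the trees, so a linear map out of it is determined by its values on trees,
-- and any map on trees extends linearly; the one non-formal point is that this extension respects
-- equality of coefficients. The operations of F_γ are the bilinear extensions of grafting, and the
-- multiplicial relations hold because both sides are trilinear and agree on trees, where they
-- become identities between graftings (up to associativity of ↓). Every tree is built from the
-- one-node tree Y by grafting, N(x, t₁; y, t₂) = t₁ ↪_x (Y ↩_y t₂), which fixes the image of each tree
-- under a morphism sending Y to e; conversely this assignment respects grafting by the relations of
-- the target algebra, so its linear extension is a morphism.

module Submission where

open import Level using (_⊔_)
open import Algebra.Bundles using (CommutativeRing; CommutativeMonoid)
open import Algebra.Core using (Op₂)
open import Algebra.Module.Bundles using (Module)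
open import Algebra.Module.Structures using (IsModule; IsLeftModule)
open import Algebra.Module.Structures.Biased using (IsModuleFromLeft)
open import Data.Bool using (true; false; if_then_else_; T)
open import Data.Fin using (Fin; toℕ)
open import Data.Fin.Properties using (_≟_; toℕ-injective)
open import Data.List using ([]; _∷_; _++_; map; length)
open import Data.List.Properties using (++-assoc; ++-identityʳ; map-++)
open import Data.Nat using (ℕ; suc; _≤_; _⊓_; _≤ᵇ_; s≤s)
open import Data.Nat.Properties
  using (≤ᵇ⇒≤; ≤⇒≤ᵇ; ≰⇒≥; m≤n⇒m⊓n≡m; m≥n⇒m⊓n≡n; ⊓-assoc; ≤-refl; ≤-trans; m≤n⇒m≤1+n)
open import Data.Product using (Σ; _×_; _,_)
open import Data.Unit using (tt)
open import Function using (_∘_; flip)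
open import Relation.Nullary using (yes)
open import Relation.Nullary.Decidable using (dec-true)
open import Relation.Binary.PropositionalEquality as ≡ using (_≡_)
import Relation.Binary.Reasoning.Setoid as SetoidReasoning

open import Defs

toℕ-↓ : ∀ {γ} (a b : Fin γ) → toℕ (a ↓ b) ≡ toℕ a ⊓ toℕ b
toℕ-↓ a b with toℕ a ≤ᵇ toℕ b in a≤ᵇb
... | true  = ≡.sym (m≤n⇒m⊓n≡m (≤ᵇ⇒≤ (toℕ a) (toℕ b) (≡.subst T (≡.sym a≤ᵇb) tt)))
... | false = ≡.sym (m≥n⇒m⊓n≡n (≰⇒≥ λ a≤b → ≡.subst T a≤ᵇb (≤⇒≤ᵇ a≤b)))

↓-assoc : ∀ {γ} (a b c : Fin γ) → a ↓ (b ↓ c) ≡ (a ↓ b) ↓ c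
↓-assoc a b c = toℕ-injective (begin
  toℕ (a ↓ (b ↓ c))         ≡⟨ toℕ-↓ a (b ↓ c) ⟩
  toℕ a ⊓ toℕ (b ↓ c)       ≡⟨ ≡.cong (toℕ a ⊓_) (toℕ-↓ b c) ⟩
  toℕ a ⊓ (toℕ b ⊓ toℕ c)   ≡⟨ ⊓-assoc (toℕ a) (toℕ b) (toℕ c) ⟨
  (toℕ a ⊓ toℕ b) ⊓ toℕ c   ≡⟨ ≡.cong (_⊓ toℕ c) (toℕ-↓ a b) ⟨
  toℕ (a ↓ b) ⊓ toℕ c       ≡⟨ toℕ-↓ (a ↓ b) c ⟨
  toℕ ((a ↓ b) ↓ c)         ∎)
  where open ≡.≡-Reasoning

mutual
  ==ᵀ-refl : ∀ {γ} (t : Tree γ) → (t ==ᵀ t) ≡ true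
  ==ᵀ-refl (node l r) rewrite ==ᶜ-refl l | ==ᶜ-refl r = ≡.refl

  ==ᶜ-refl : ∀ {γ} (c : Child γ) → (c ==ᶜ c) ≡ true
  ==ᶜ-refl leaf      = ≡.refl
  ==ᶜ-refl (sub a t) rewrite dec-true (a ≟ a) ≡.refl | ==ᵀ-refl t = ≡.refl

mutual
  ==ᵀ⇒≡ : ∀ {γ} (t s : Tree γ) → (t ==ᵀ s) ≡ true → t ≡ s
  ==ᵀ⇒≡ (node l r) (node l' r') eq with l ==ᶜ l' in l==l'
  ... | true = ≡.cong₂ node (==ᶜ⇒≡ l l' l==l') (==ᶜ⇒≡ r r' eq)

  ==ᶜ⇒≡ : ∀ {γ} (c d : Child γ) → (c ==ᶜ d) ≡ true → c ≡ d
  ==ᶜ⇒≡ leaf      leaf      _  = ≡.refl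
  ==ᶜ⇒≡ (sub a t) (sub a' t') eq with a ≟ a'
  ... | yes ≡.refl = ≡.cong (sub a) (==ᵀ⇒≡ t t' eq)

graftR-graftL-assoc : ∀ {γ} (a a' : Fin γ) x y z →
  graftR a (graftL a' x y) z ≡ graftL a' x (graftR a y z)
graftR-graftL-assoc a a' x (node l r) z = ≡.refl

mutual
  graftR-assoc : ∀ {γ} (a a' : Fin γ) x y z →
    graftR a (graftR a' x y) z ≡ graftR (a ↓ a') x (graftR a y z)
  graftR-assoc a a' (node l r) y z = ≡.cong (node l) (graftRᶜ-assoc a a' r y z)

  graftRᶜ-assoc : ∀ {γ} (a a' : Fin γ) r y z →
    graftRᶜ a (graftRᶜ a' r y) z ≡ graftRᶜ (a ↓ a') r (graftR a y z)
  graftRᶜ-assoc a a' leaf      y z = ≡.refl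
  graftRᶜ-assoc a a' (sub b t) y z = ≡.cong₂ sub (↓-assoc a a' b) (graftR-assoc a a' t y z)

mutual
  graftL-assoc : ∀ {γ} (a a' : Fin γ) x y z →
    graftL (a ↓ a') (graftL a x y) z ≡ graftL a x (graftL a' y z)
  graftL-assoc a a' x y (node l r) = ≡.cong (λ l' → node l' r) (graftLᶜ-assoc a a' x y l)

  graftLᶜ-assoc : ∀ {γ} (a a' : Fin γ) x y l →
    graftLᶜ (a ↓ a') (graftL a x y) l ≡ graftLᶜ a x (graftLᶜ a' y l)
  graftLᶜ-assoc a a' x y leaf      = ≡.refl
  graftLᶜ-assoc a a' x y (sub b t) = ≡.cong₂ sub (≡.sym (↓-assoc a a' b)) (graftL-assoc a a' x y t)

-- The module of linear combinations of trees

module _ {c ℓ} (R : CommutativeRing c ℓ) (γ : ℕ) where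
  open CommutativeRing R
  open FreeConstruction R γ
  open import Algebra.Properties.Ring ring using (-0#≈0#; -‿+-comm)

  basis : Tree γ → F
  basis t = (1# , t) ∷ []

  if-cong : ∀ b {k k'} → k ≈ k' → (if b then k else 0#) ≈ (if b then k' else 0#)
  if-cong true  k≈k' = k≈k'
  if-cong false _    = refl

  if-homo : ∀ b (g : Carrier → Carrier) {k} → g 0# ≈ 0# →
            (if b then g k else 0#) ≈ g (if b then k else 0#)
  if-homo true  g _    = refl
  if-homo false g g0≈0 = sym g0≈0

  coeff-++ : ∀ t u v → coeff t (u ++ v) ≈ coeff t u + coeff t v
  coeff-++ t []            v = sym (+-identityˡ _)
  coeff-++ t ((k , s) ∷ u) v = trans (+-congˡ (coeff-++ t u v)) (sym (+-assoc _ _ _))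

  coeff-*ₗ : ∀ t k u → coeff t (k *ₗF u) ≈ k * coeff t u
  coeff-*ₗ t k []             = sym (zeroʳ k)
  coeff-*ₗ t k ((k' , s) ∷ u) =
    trans (+-cong (if-homo (t ==ᵀ s) (k *_) (zeroʳ k)) (coeff-*ₗ t k u)) (sym (distribˡ k _ _))

  coeff-neg : ∀ t u → coeff t (-F u) ≈ - coeff t u
  coeff-neg t []            = sym -0#≈0#
  coeff-neg t ((k , s) ∷ u) =
    trans (+-cong (if-homo (t ==ᵀ s) -_ -0#≈0#) (coeff-neg t u)) (-‿+-comm _ _)

  isModuleF : IsModule R _≈F_ _+F_ 0F -F_ _*ₗF_ _*ᵣF_
  isModuleF = IsModuleFromLeft.isModule (record { isLeftModule = isLeftModule })
    where
    open SetoidReasoning setoid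

    ≡⇒≈F : ∀ {u v} → u ≡ v → u ≈F v
    ≡⇒≈F ≡.refl t = refl

    isLeftModule : IsLeftModule ring _≈F_ _+F_ 0F -F_ _*ₗF_
    isLeftModule = record
      { isLeftSemimodule = record
        { +ᴹ-isCommutativeMonoid = record
          { isMonoid = record
            { isSemigroup = record
              { isMagma = record
                { isEquivalence = record
                  { refl  = λ t → refl
                  ; sym   = λ u≈v t → sym (u≈v t)
                  ; trans = λ u≈v v≈w t → trans (u≈v t) (v≈w t)
                  }
                ; ∙-cong = λ {u} {u'} {v} {v'} u≈u' v≈v' t →
                    trans (coeff-++ t u v) (trans (+-cong (u≈u' t) (v≈v' t)) (sym (coeff-++ t u' v')))
                }
              ; assoc = λ u v w → ≡⇒≈F (++-assoc u v w)
              }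
            ; identity = (λ u t → refl) , (λ u → ≡⇒≈F (++-identityʳ u))
            }
          ; comm = λ u v t → trans (coeff-++ t u v) (trans (+-comm _ _) (sym (coeff-++ t v u)))
          }
        ; isPreleftSemimodule = record
          { *ₗ-cong = λ {k} {k'} {u} {u'} k≈k' u≈u' t →
              trans (coeff-*ₗ t k u) (trans (*-cong k≈k' (u≈u' t)) (sym (coeff-*ₗ t k' u')))
          ; *ₗ-zeroˡ = λ u t → trans (coeff-*ₗ t 0# u) (zeroˡ _)
          ; *ₗ-distribʳ = λ u k k' t → begin
              coeff t ((k + k') *ₗF u)                    ≈⟨ coeff-*ₗ t (k + k') u ⟩
              (k + k') * coeff t u                        ≈⟨ distribʳ _ k k' ⟩
              k * coeff t u + k' * coeff t u              ≈⟨ +-cong (coeff-*ₗ t k u) (coeff-*ₗ t k' u) ⟨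
              coeff t (k *ₗF u) + coeff t (k' *ₗF u)      ≈⟨ coeff-++ t (k *ₗF u) (k' *ₗF u) ⟨
              coeff t ((k *ₗF u) +F (k' *ₗF u))           ∎
          ; *ₗ-identityˡ = λ u t → trans (coeff-*ₗ t 1# u) (*-identityˡ _)
          ; *ₗ-assoc = λ k k' u t → begin
              coeff t ((k * k') *ₗF u)     ≈⟨ coeff-*ₗ t (k * k') u ⟩
              (k * k') * coeff t u         ≈⟨ *-assoc k k' _ ⟩
              k * (k' * coeff t u)         ≈⟨ *-congˡ (coeff-*ₗ t k' u) ⟨
              k * coeff t (k' *ₗF u)       ≈⟨ coeff-*ₗ t k (k' *ₗF u) ⟨
              coeff t (k *ₗF (k' *ₗF u))   ∎
          ; *ₗ-zeroʳ = λ k t → refl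
          ; *ₗ-distribˡ = λ k u v → ≡⇒≈F (map-++ _ u v)
          }
        }
      ; -ᴹ‿cong = λ {u} {u'} u≈u' t → trans (coeff-neg t u) (trans (-‿cong (u≈u' t)) (sym (coeff-neg t u')))
      ; -ᴹ‿inverse = (λ u t → trans (coeff-++ t (-F u) u) (trans (+-congʳ (coeff-neg t u)) (-‿inverseˡ _)))
                   , (λ u t → trans (coeff-++ t u (-F u)) (trans (+-congˡ (coeff-neg t u)) (-‿inverseʳ _)))
      }

  FModule : Module R c ℓ
  FModule = record { isModule = isModuleF }

  remove : Tree γ → F → F
  remove t []            = []
  remove t ((k , s) ∷ u) = if t ==ᵀ s then remove t u else (k , s) ∷ remove t u

  length-remove : ∀ t u → length (remove t u) ≤ length u
  length-remove t []            = ≤-refl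
  length-remove t ((k , s) ∷ u) with t ==ᵀ s
  ... | true  = m≤n⇒m≤1+n (length-remove t u)
  ... | false = s≤s (length-remove t u)

  length-remove-head : ∀ k t u → length (remove t ((k , t) ∷ u)) ≤ length u
  length-remove-head k t u rewrite ==ᵀ-refl t = length-remove t u

  coeff-remove-self : ∀ t u → coeff t (remove t u) ≈ 0#
  coeff-remove-self t []            = refl
  coeff-remove-self t ((k , s) ∷ u) with t ==ᵀ s in t==s
  ... | true  = coeff-remove-self t u
  ... | false rewrite t==s = trans (+-identityˡ _) (coeff-remove-self t u)

  coeff-remove-other : ∀ t s u → (s ==ᵀ t) ≡ false → coeff s (remove t u) ≈ coeff s u
  coeff-remove-other t s []             _      = refl
  coeff-remove-other t s ((k , s') ∷ u) s≠t with t ==ᵀ s' in t==s'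
  ... | false = +-congˡ (coeff-remove-other t s u s≠t)
  ... | true with ≡.refl ← ==ᵀ⇒≡ t s' t==s' rewrite s≠t =
    trans (coeff-remove-other t s u s≠t) (sym (+-identityˡ _))

  remove-vanishes : ∀ t u → u ≈F [] → remove t u ≈F []
  remove-vanishes t u u≈0 s with s ==ᵀ t in s==t
  ... | true with ≡.refl ← ==ᵀ⇒≡ s t s==t = coeff-remove-self t u
  ... | false = trans (coeff-remove-other t s u s==t) (u≈0 s)

  difference-vanishes : ∀ u v → u ≈F v → (u +F (-F v)) ≈F 0F
  difference-vanishes u v u≈v t =
    trans (coeff-++ t u (-F v)) (trans (+-cong (u≈v t) (coeff-neg t v)) (-‿inverseʳ _))

  singleton≈*ₗbasis : ∀ k t → ((k , t) ∷ []) ≈F (k *ₗF basis t)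
  singleton≈*ₗbasis k t s = +-congʳ (if-cong (s ==ᵀ t) (sym (*-identityʳ k)))

  -- Linear extension of maps on trees

  record IsLinear {m ℓm} (M : Module R m ℓm) (f : F → Module.Carrierᴹ M) : Set (c ⊔ ℓ ⊔ ℓm) where
    open Module M
    field
      cong    : ∀ {u v} → u ≈F v → f u ≈ᴹ f v
      +-homo  : ∀ u v → f (u +F v) ≈ᴹ f u +ᴹ f v
      *ₗ-homo : ∀ k u → f (k *ₗF u) ≈ᴹ k *ₗ f u

  record IsBilinear {m ℓm} (M : Module R m ℓm) (B : F → F → Module.Carrierᴹ M) : Set (c ⊔ ℓ ⊔ ℓm) where
    field
      linearˡ : ∀ v → IsLinear M (λ u → B u v)
      linearʳ : ∀ u → IsLinear M (B u)

  module LinearExtension {m ℓm} (M : Module R m ℓm) where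
    open Module M
    open SetoidReasoning ≈ᴹ-setoid
    open import Algebra.Properties.AbelianGroup +ᴹ-abelianGroup
      using (ε⁻¹≈ε; inverseʳ-unique; x∙y⁻¹≈ε⇒x≈y; ⁻¹-∙-comm)
    open import Algebra.Properties.CommutativeSemigroup
      (CommutativeMonoid.commutativeSemigroup +ᴹ-commutativeMonoid) using (x∙yz≈y∙xz)

    extend : (Tree γ → Carrierᴹ) → F → Carrierᴹ
    extend h []            = 0ᴹ
    extend h ((k , t) ∷ u) = k *ₗ h t +ᴹ extend h u

    extend-basis : ∀ h t → extend h (basis t) ≈ᴹ h t
    extend-basis h t = ≈ᴹ-trans (+ᴹ-identityʳ _) (*ₗ-identityˡ (h t))

    extend-++ : ∀ h u v → extend h (u +F v) ≈ᴹ extend h u +ᴹ extend h v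
    extend-++ h []            v = ≈ᴹ-sym (+ᴹ-identityˡ _)
    extend-++ h ((k , t) ∷ u) v = ≈ᴹ-trans (+ᴹ-congˡ (extend-++ h u v)) (≈ᴹ-sym (+ᴹ-assoc _ _ _))

    extend-*ₗ : ∀ h k u → extend h (k *ₗF u) ≈ᴹ k *ₗ extend h u
    extend-*ₗ h k []             = ≈ᴹ-sym (*ₗ-zeroʳ k)
    extend-*ₗ h k ((k' , t) ∷ u) = begin
      (k * k') *ₗ h t +ᴹ extend h (k *ₗF u)   ≈⟨ +ᴹ-cong (*ₗ-assoc k k' (h t)) (extend-*ₗ h k u) ⟩
      k *ₗ (k' *ₗ h t) +ᴹ k *ₗ extend h u     ≈⟨ *ₗ-distribˡ k _ _ ⟨
      k *ₗ (k' *ₗ h t +ᴹ extend h u)          ∎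

    -‿*ₗ : ∀ k x → (- k) *ₗ x ≈ᴹ -ᴹ (k *ₗ x)
    -‿*ₗ k x = inverseʳ-unique (k *ₗ x) ((- k) *ₗ x) (begin
      k *ₗ x +ᴹ (- k) *ₗ x   ≈⟨ *ₗ-distribʳ x k (- k) ⟨
      (k + - k) *ₗ x         ≈⟨ *ₗ-congʳ (-‿inverseʳ k) ⟩
      0# *ₗ x                ≈⟨ *ₗ-zeroˡ x ⟩
      0ᴹ                     ∎)

    extend-neg : ∀ h u → extend h (-F u) ≈ᴹ -ᴹ extend h u
    extend-neg h []            = ≈ᴹ-sym ε⁻¹≈ε
    extend-neg h ((k , t) ∷ u) = begin
      (- k) *ₗ h t +ᴹ extend h (-F u)         ≈⟨ +ᴹ-cong (-‿*ₗ k (h t)) (extend-neg h u) ⟩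
      -ᴹ (k *ₗ h t) +ᴹ -ᴹ extend h u          ≈⟨ ⁻¹-∙-comm _ _ ⟩
      -ᴹ (k *ₗ h t +ᴹ extend h u)             ∎

    extend-remove : ∀ h t u → extend h u ≈ᴹ coeff t u *ₗ h t +ᴹ extend h (remove t u)
    extend-remove h t [] = ≈ᴹ-sym (≈ᴹ-trans (+ᴹ-congʳ (*ₗ-zeroˡ _)) (+ᴹ-identityˡ _))
    extend-remove h t ((k , s) ∷ u) with t ==ᵀ s in t==s
    ... | true with ≡.refl ← ==ᵀ⇒≡ t s t==s = begin
      k *ₗ h t +ᴹ extend h u                                    ≈⟨ +ᴹ-congˡ (extend-remove h t u) ⟩
      k *ₗ h t +ᴹ (coeff t u *ₗ h t +ᴹ extend h (remove t u))   ≈⟨ +ᴹ-assoc _ _ _ ⟨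
      (k *ₗ h t +ᴹ coeff t u *ₗ h t) +ᴹ extend h (remove t u)   ≈⟨ +ᴹ-congʳ (*ₗ-distribʳ _ _ _) ⟨
      (k + coeff t u) *ₗ h t +ᴹ extend h (remove t u)           ∎
    ... | false = begin
      k *ₗ h s +ᴹ extend h u                                          ≈⟨ +ᴹ-congˡ (extend-remove h t u) ⟩
      k *ₗ h s +ᴹ (coeff t u *ₗ h t +ᴹ extend h (remove t u))         ≈⟨ x∙yz≈y∙xz _ _ _ ⟩
      coeff t u *ₗ h t +ᴹ (k *ₗ h s +ᴹ extend h (remove t u))         ≈⟨ +ᴹ-congʳ (*ₗ-congʳ (+-identityˡ _)) ⟨
      (0# + coeff t u) *ₗ h t +ᴹ (k *ₗ h s +ᴹ extend h (remove t u))  ∎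

    -- Strong induction on the length: removing every occurrence of the first tree shortens u.
    extend-vanishes : ∀ h u → u ≈F [] → extend h u ≈ᴹ 0ᴹ
    extend-vanishes h u = go (length u) u ≤-refl
      where
      go : ∀ n u → length u ≤ n → u ≈F [] → extend h u ≈ᴹ 0ᴹ
      go _       []            _           _   = ≈ᴹ-refl
      go (suc n) ((k , t) ∷ u) (s≤s |u|≤n) u≈0 = begin
        extend h ((k , t) ∷ u)                                              ≈⟨ extend-remove h t ((k , t) ∷ u) ⟩
        coeff t ((k , t) ∷ u) *ₗ h t +ᴹ extend h (remove t ((k , t) ∷ u))  ≈⟨ +ᴹ-cong head rest ⟩
        0ᴹ +ᴹ 0ᴹ                                                            ≈⟨ +ᴹ-identityˡ 0ᴹ ⟩
        0ᴹ                                                                  ∎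
        where
        head : coeff t ((k , t) ∷ u) *ₗ h t ≈ᴹ 0ᴹ
        head = ≈ᴹ-trans (*ₗ-congʳ (u≈0 t)) (*ₗ-zeroˡ (h t))
        rest : extend h (remove t ((k , t) ∷ u)) ≈ᴹ 0ᴹ
        rest = go n (remove t ((k , t) ∷ u)) (≤-trans (length-remove-head k t u) |u|≤n) (remove-vanishes t ((k , t) ∷ u) u≈0)

    extend-cong : ∀ h {u v} → u ≈F v → extend h u ≈ᴹ extend h v
    extend-cong h {u} {v} u≈v = x∙y⁻¹≈ε⇒x≈y (extend h u) (extend h v) (begin
      extend h u +ᴹ -ᴹ extend h v     ≈⟨ +ᴹ-congˡ (extend-neg h v) ⟨
      extend h u +ᴹ extend h (-F v)   ≈⟨ extend-++ h u (-F v) ⟨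
      extend h (u +F (-F v))            ≈⟨ extend-vanishes h (u +F (-F v)) (difference-vanishes u v u≈v) ⟩
      0ᴹ                              ∎)

    extend-linear : ∀ h → IsLinear M (extend h)
    extend-linear h = record { cong = λ {u} {v} → extend-cong h {u} {v} ; +-homo = extend-++ h ; *ₗ-homo = extend-*ₗ h }

    open IsLinear

    linear-resp : ∀ {f g} → (∀ u → f u ≈ᴹ g u) → IsLinear M g → IsLinear M f
    linear-resp {f} {g} f≈g g-linear = record
      { cong    = λ {u} {v} u≈v → begin f u ≈⟨ f≈g u ⟩ g u ≈⟨ cong g-linear u≈v ⟩ g v ≈⟨ f≈g v ⟨ f v ∎
      ; +-homo  = λ u v → ≈ᴹ-trans (f≈g (u +F v))
                            (≈ᴹ-trans (+-homo g-linear u v) (≈ᴹ-sym (+ᴹ-cong (f≈g u) (f≈g v))))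
      ; *ₗ-homo = λ k u → ≈ᴹ-trans (f≈g (k *ₗF u))
                            (≈ᴹ-trans (*ₗ-homo g-linear k u) (*ₗ-congˡ (≈ᴹ-sym (f≈g u))))
      }

    linear-∘ : ∀ {g f} → IsLinear M g → IsLinear FModule f → IsLinear M (g ∘ f)
    linear-∘ {g} {f} g-linear f-linear = record
      { cong    = λ {u} {v} u≈v → cong g-linear (cong f-linear {u} {v} u≈v)
      ; +-homo  = λ u v → ≈ᴹ-trans (cong g-linear {f (u +F v)} {f u +F f v} (+-homo f-linear u v))
                                    (+-homo g-linear (f u) (f v))
      ; *ₗ-homo = λ k u → ≈ᴹ-trans (cong g-linear {f (k *ₗF u)} {k *ₗF f u} (*ₗ-homo f-linear k u))
                                    (*ₗ-homo g-linear k (f u))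
      }

    linear-∘-bilinear : ∀ {g B} → IsLinear M g → IsBilinear FModule B → IsBilinear M (λ u v → g (B u v))
    linear-∘-bilinear g-linear B-bilinear = record
      { linearˡ = λ v → linear-∘ g-linear (IsBilinear.linearˡ B-bilinear v)
      ; linearʳ = λ u → linear-∘ g-linear (IsBilinear.linearʳ B-bilinear u)
      }

    linear-[] : ∀ {f} → IsLinear M f → f [] ≈ᴹ 0ᴹ
    linear-[] {f} f-linear = ≈ᴹ-trans (*ₗ-homo f-linear 0# []) (*ₗ-zeroˡ (f []))

    linear-∷ : ∀ {f} → IsLinear M f → ∀ k t u → f ((k , t) ∷ u) ≈ᴹ k *ₗ f (basis t) +ᴹ f u
    linear-∷ {f} f-linear k t u = begin
      f (((k , t) ∷ []) +F u)        ≈⟨ +-homo f-linear ((k , t) ∷ []) u ⟩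
      f ((k , t) ∷ []) +ᴹ f u        ≈⟨ +ᴹ-congʳ (cong f-linear (singleton≈*ₗbasis k t)) ⟩
      f (k *ₗF basis t) +ᴹ f u       ≈⟨ +ᴹ-congʳ (*ₗ-homo f-linear k (basis t)) ⟩
      k *ₗ f (basis t) +ᴹ f u        ∎

    linear-unique : ∀ {f g} → IsLinear M f → IsLinear M g →
                    (∀ t → f (basis t) ≈ᴹ g (basis t)) → ∀ u → f u ≈ᴹ g u
    linear-unique {f} {g} f-linear g-linear f≈g []            =
      ≈ᴹ-trans (linear-[] f-linear) (≈ᴹ-sym (linear-[] g-linear))
    linear-unique {f} {g} f-linear g-linear f≈g ((k , t) ∷ u) = begin
      f ((k , t) ∷ u)            ≈⟨ linear-∷ f-linear k t u ⟩
      k *ₗ f (basis t) +ᴹ f u    ≈⟨ +ᴹ-cong (*ₗ-congˡ (f≈g t)) (linear-unique f-linear g-linear f≈g u) ⟩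
      k *ₗ g (basis t) +ᴹ g u    ≈⟨ linear-∷ g-linear k t u ⟨
      g ((k , t) ∷ u)            ∎

    bilinear-unique : ∀ {B B'} → IsBilinear M B → IsBilinear M B' →
                      (∀ t s → B (basis t) (basis s) ≈ᴹ B' (basis t) (basis s)) →
                      ∀ u v → B u v ≈ᴹ B' u v
    bilinear-unique B-bilinear B'-bilinear B≈B' u v =
      linear-unique (linearˡ B-bilinear v) (linearˡ B'-bilinear v)
        (λ t → linear-unique (linearʳ B-bilinear (basis t)) (linearʳ B'-bilinear (basis t)) (B≈B' t) v) u
      where open IsBilinear

    record IsBilinearOp (O : Op₂ Carrierᴹ) : Set (c ⊔ m ⊔ ℓm) where
      field
        cong     : ∀ {x x' y y'} → x ≈ᴹ x' → y ≈ᴹ y' → O x y ≈ᴹ O x' y'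
        +-distribʳ : ∀ x x' y → O (x +ᴹ x') y ≈ᴹ O x y +ᴹ O x' y
        +-distribˡ : ∀ x y y' → O x (y +ᴹ y') ≈ᴹ O x y +ᴹ O x y'
        scaleˡ   : ∀ k x y → O (k *ₗ x) y ≈ᴹ k *ₗ O x y
        scaleʳ   : ∀ k x y → O x (k *ₗ y) ≈ᴹ k *ₗ O x y

    bilinearOp-∘ : ∀ {O f} → IsBilinearOp O → IsLinear M f → IsBilinear M (λ u v → O (f u) (f v))
    bilinearOp-∘ {O} {f} O-bilinear f-linear = record
      { linearˡ = λ v → record
        { cong    = λ {u} {u'} u≈u' → O.cong (cong f-linear {u} {u'} u≈u') ≈ᴹ-refl
        ; +-homo  = λ u u' → ≈ᴹ-trans (O.cong (+-homo f-linear u u') ≈ᴹ-refl) (O.+-distribʳ _ _ _)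
        ; *ₗ-homo = λ k u → ≈ᴹ-trans (O.cong (*ₗ-homo f-linear k u) ≈ᴹ-refl) (O.scaleˡ _ _ _)
        }
      ; linearʳ = λ u → record
        { cong    = λ {v} {v'} v≈v' → O.cong ≈ᴹ-refl (cong f-linear {v} {v'} v≈v')
        ; +-homo  = λ v v' → ≈ᴹ-trans (O.cong ≈ᴹ-refl (+-homo f-linear v v')) (O.+-distribˡ _ _ _)
        ; *ₗ-homo = λ k v → ≈ᴹ-trans (O.cong ≈ᴹ-refl (*ₗ-homo f-linear k v)) (O.scaleʳ _ _ _)
        }
      }
      where module O = IsBilinearOp O-bilinear

  -- The multiplicial structure of F_γ

  module _ where
    open LinearExtension FModule
    open IsLinear

    -- bilin op ((k , t) ∷ u) v reduces to row op k t v ++ bilin op u v.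
    row : (Tree γ → Tree γ → Tree γ) → Carrier → Tree γ → F → F
    row op k t v = map (λ (k' , s) → (k * k' , op t s)) v

    coeff-row : ∀ op k t v s → coeff s (row op k t v) ≈ k * coeff s (row op 1# t v)
    coeff-row op k t []             s = sym (zeroʳ k)
    coeff-row op k t ((k' , r) ∷ v) s = begin
      (if s ==ᵀ op t r then k * k' else 0#) + coeff s (row op k t v)
        ≈⟨ +-cong (if-cong (s ==ᵀ op t r) (*-congˡ (sym (*-identityˡ k')))) (coeff-row op k t v s) ⟩
      (if s ==ᵀ op t r then k * (1# * k') else 0#) + k * coeff s (row op 1# t v)
        ≈⟨ +-congʳ (if-homo (s ==ᵀ op t r) (k *_) (zeroʳ k)) ⟩
      k * (if s ==ᵀ op t r then 1# * k' else 0#) + k * coeff s (row op 1# t v)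
        ≈⟨ distribˡ k _ _ ⟨
      k * coeff s (row op 1# t ((k' , r) ∷ v))
        ∎
      where open SetoidReasoning setoid

    bilin≈extend : ∀ op v u → bilin op u v ≈F extend (λ t → row op 1# t v) u
    bilin≈extend op v []            s = refl
    bilin≈extend op v ((k , t) ∷ u) s = begin
      coeff s (row op k t v ++ bilin op u v)
        ≈⟨ coeff-++ s (row op k t v) (bilin op u v) ⟩
      coeff s (row op k t v) + coeff s (bilin op u v)
        ≈⟨ +-cong (trans (coeff-row op k t v s) (sym (coeff-*ₗ s k (row op 1# t v)))) (bilin≈extend op v u s) ⟩
      coeff s (k *ₗF row op 1# t v) + coeff s (extend (λ t → row op 1# t v) u)
        ≈⟨ coeff-++ s (k *ₗF row op 1# t v) (extend (λ t → row op 1# t v) u) ⟨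
      coeff s (extend (λ t → row op 1# t v) ((k , t) ∷ u))
        ∎
      where open SetoidReasoning setoid

    bilin-linearˡ : ∀ op v → IsLinear FModule (λ u → bilin op u v)
    bilin-linearˡ op v = linear-resp (bilin≈extend op v) (extend-linear (λ t → row op 1# t v))

    bilin-[]ʳ : ∀ op u → bilin op u [] ≡ []
    bilin-[]ʳ op []            = ≡.refl
    bilin-[]ʳ op ((k , t) ∷ u) = bilin-[]ʳ op u

    coeff-bilin-∷ʳ : ∀ op k a u v s →
      coeff s (bilin op u ((k , a) ∷ v)) ≈ coeff s (row (flip op) k a u) + coeff s (bilin op u v)
    coeff-bilin-∷ʳ op k a []             v s = sym (+-identityʳ 0#)
    coeff-bilin-∷ʳ op k a ((k' , b) ∷ u) v s = begin
      x + coeff s (row op k' b v ++ bilin op u ((k , a) ∷ v))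
        ≈⟨ +-cong (if-cong (s ==ᵀ op b a) (*-comm k' k))
                  (trans (coeff-++ s (row op k' b v) _) (+-congˡ (coeff-bilin-∷ʳ op k a u v s))) ⟩
      y + (coeff s (row op k' b v) + (coeff s (row (flip op) k a u) + coeff s (bilin op u v)))
        ≈⟨ +-congˡ (x∙yz≈y∙xz _ _ _) ⟩
      y + (coeff s (row (flip op) k a u) + (coeff s (row op k' b v) + coeff s (bilin op u v)))
        ≈⟨ +-assoc _ _ _ ⟨
      (y + coeff s (row (flip op) k a u)) + (coeff s (row op k' b v) + coeff s (bilin op u v))
        ≈⟨ +-congˡ (coeff-++ s (row op k' b v) (bilin op u v)) ⟨
      (y + coeff s (row (flip op) k a u)) + coeff s (row op k' b v ++ bilin op u v)
        ∎
      where
      open SetoidReasoning setoid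
      open import Algebra.Properties.CommutativeSemigroup +-commutativeSemigroup using (x∙yz≈y∙xz)
      x y : Carrier
      x = if s ==ᵀ op b a then k' * k else 0#
      y = if s ==ᵀ op b a then k * k' else 0#

    bilin-flip : ∀ op u v → bilin op u v ≈F bilin (flip op) v u
    bilin-flip op []            v s = reflexive (≡.cong (coeff s) (≡.sym (bilin-[]ʳ (flip op) v)))
    bilin-flip op ((k , a) ∷ u) v s =
      trans (coeff-++ s (row op k a v) (bilin op u v))
        (trans (+-congˡ (bilin-flip op u v s)) (sym (coeff-bilin-∷ʳ (flip op) k a v u s)))

    bilin-linearʳ : ∀ op u → IsLinear FModule (bilin op u)
    bilin-linearʳ op u = linear-resp (bilin-flip op u) (bilin-linearˡ (flip op) u)

    bilin-bilinear : ∀ op → IsBilinear FModule (bilin op)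
    bilin-bilinear op = record { linearˡ = bilin-linearˡ op ; linearʳ = bilin-linearʳ op }

    bilin-basis : ∀ op t s → bilin op (basis t) (basis s) ≈F basis (op t s)
    bilin-basis op t s r = +-congʳ (if-cong (r ==ᵀ op t s) (*-identityˡ 1#))

    bilin-cong : ∀ op {x x' y y'} → x ≈F x' → y ≈F y' → bilin op x y ≈F bilin op x' y'
    bilin-cong op {x} {x'} {y} {y'} x≈x' y≈y' s =
      trans (cong (bilin-linearˡ op y) {x} {x'} x≈x' s) (cong (bilin-linearʳ op x') {y} {y'} y≈y' s)

    bilin-assoc : ∀ op op' op'' op''' → (∀ t s r → op (op' t s) r ≡ op'' t (op''' s r)) →
                  ∀ x y z → bilin op (bilin op' x y) z ≈F bilin op'' x (bilin op''' y z)
    bilin-assoc op op' op'' op''' assoc x y z =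
      linear-unique (linear-∘ (bilin-linearˡ op z) (bilin-linearˡ op' y)) (bilin-linearˡ op'' _)
        (λ t → bilinear-unique (lhs-bilinear t)
                 (linear-∘-bilinear (bilin-linearʳ op'' (basis t)) (bilin-bilinear op'''))
                 (on-basis t) y z)
        x
      where
      lhs-bilinear : ∀ t → IsBilinear FModule (λ y z → bilin op (bilin op' (basis t) y) z)
      lhs-bilinear t = record
        { linearˡ = λ z → linear-∘ (bilin-linearˡ op z) (bilin-linearʳ op' (basis t))
        ; linearʳ = λ y → bilin-linearʳ op (bilin op' (basis t) y)
        }
      on-basis : ∀ t s r → bilin op (bilin op' (basis t) (basis s)) (basis r)
                           ≈F bilin op'' (basis t) (bilin op''' (basis s) (basis r))
      on-basis t s r w rewrite assoc t s r = +-congʳ (if-cong (w ==ᵀ op'' t (op''' s r)) (*-assoc 1# 1# 1#))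

    isMultiplicialF : IsMultiplicial R _≈F_ _+F_ _*ₗF_ γ ↩F ↪F
    isMultiplicialF = record
      { ↩-cong     = λ a {x} {x'} {y} {y'} → bilin-cong (graftR a) {x} {x'} {y} {y'}
      ; ↪-cong     = λ a {x} {x'} {y} {y'} → bilin-cong (graftL a) {x} {x'} {y} {y'}
      ; ↩-distribʳ = λ a x x' y → +-homo (bilin-linearˡ (graftR a) y) x x'
      ; ↩-distribˡ = λ a x → +-homo (bilin-linearʳ (graftR a) x)
      ; ↪-distribʳ = λ a x x' y → +-homo (bilin-linearˡ (graftL a) y) x x'
      ; ↪-distribˡ = λ a x → +-homo (bilin-linearʳ (graftL a) x)
      ; ↩-scaleˡ   = λ a k x y → *ₗ-homo (bilin-linearˡ (graftR a) y) k x
      ; ↩-scaleʳ   = λ a k x → *ₗ-homo (bilin-linearʳ (graftR a) x) k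
      ; ↪-scaleˡ   = λ a k x y → *ₗ-homo (bilin-linearˡ (graftL a) y) k x
      ; ↪-scaleʳ   = λ a k x → *ₗ-homo (bilin-linearʳ (graftL a) x) k
      ; rel₁ = λ a a' → bilin-assoc (graftR a) (graftL a') (graftL a') (graftR a) (graftR-graftL-assoc a a')
      ; rel₂ = λ a a' → bilin-assoc (graftR a) (graftR a') (graftR (a ↓ a')) (graftR a) (graftR-assoc a a')
      ; rel₃ = λ a a' → bilin-assoc (graftL (a ↓ a')) (graftL a) (graftL a) (graftL a') (graftL-assoc a a')
      }

  -- The universal property

  module _ {m ℓm} (M : Module R m ℓm) where
    open Module M
    open LinearExtension M
    open SetoidReasoning ≈ᴹ-setoid

    extend-bilin : ∀ {op O} h → IsBilinearOp O → (∀ t s → h (op t s) ≈ᴹ O (h t) (h s)) →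
                   ∀ u v → extend h (bilin op u v) ≈ᴹ O (extend h u) (extend h v)
    extend-bilin {op} {O} h O-bilinear h-op = bilinear-unique
      (linear-∘-bilinear (extend-linear h) (bilin-bilinear op))
      (bilinearOp-∘ O-bilinear (extend-linear h))
      λ t s → begin
        extend h (bilin op (basis t) (basis s))
          ≈⟨ extend-cong h {bilin op (basis t) (basis s)} {basis (op t s)} (bilin-basis op t s) ⟩
        extend h (basis (op t s))                     ≈⟨ extend-basis h (op t s) ⟩
        h (op t s)                                    ≈⟨ h-op t s ⟩
        O (h t) (h s)                                 ≈⟨ IsBilinearOp.cong O-bilinear (extend-basis h t) (extend-basis h s) ⟨
        O (extend h (basis t)) (extend h (basis s))   ∎

  module _ {m ℓm} (A : MultiplicialAlgebra R γ m ℓm) (e : MultiplicialAlgebra.Carrierᴹ A) where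
    open MultiplicialAlgebra A
    open IsMultiplicial isMultiplicial
    open LinearExtension module′
    open SetoidReasoning ≈ᴹ-setoid

    mutual
      ⟦_⟧ : Tree γ → Carrierᴹ
      ⟦ node l r ⟧ = ⟦ l ⟧ˡ ⟦ r ⟧ʳ

      ⟦_⟧ʳ : Child γ → Carrierᴹ
      ⟦ leaf    ⟧ʳ = e
      ⟦ sub y t ⟧ʳ = ↩ y e ⟦ t ⟧

      ⟦_⟧ˡ_ : Child γ → Carrierᴹ → Carrierᴹ
      ⟦ leaf    ⟧ˡ x = x
      ⟦ sub a t ⟧ˡ x = ↪ a ⟦ t ⟧ x

    ⟦⟧ˡ-↩ : ∀ a l x y → ⟦ l ⟧ˡ (↩ a x y) ≈ᴹ ↩ a (⟦ l ⟧ˡ x) y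
    ⟦⟧ˡ-↩ a leaf      x y = ≈ᴹ-refl
    ⟦⟧ˡ-↩ a (sub b t) x y = ≈ᴹ-sym (rel₁ a b ⟦ t ⟧ x y)

    mutual
      ⟦⟧-graftR : ∀ a t s → ⟦ graftR a t s ⟧ ≈ᴹ ↩ a ⟦ t ⟧ ⟦ s ⟧
      ⟦⟧-graftR a (node l r) s = begin
        ⟦ l ⟧ˡ ⟦ graftRᶜ a r s ⟧ʳ    ≈⟨ ⟦⟧ˡ-cong l (⟦⟧ʳ-graftR a r s) ⟩
        ⟦ l ⟧ˡ (↩ a ⟦ r ⟧ʳ ⟦ s ⟧)    ≈⟨ ⟦⟧ˡ-↩ a l ⟦ r ⟧ʳ ⟦ s ⟧ ⟩
        ↩ a (⟦ l ⟧ˡ ⟦ r ⟧ʳ) ⟦ s ⟧    ∎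
        where
        ⟦⟧ˡ-cong : ∀ l {x y} → x ≈ᴹ y → ⟦ l ⟧ˡ x ≈ᴹ ⟦ l ⟧ˡ y
        ⟦⟧ˡ-cong leaf      x≈y = x≈y
        ⟦⟧ˡ-cong (sub b t) x≈y = ↪-cong b ≈ᴹ-refl x≈y

      ⟦⟧ʳ-graftR : ∀ a r s → ⟦ graftRᶜ a r s ⟧ʳ ≈ᴹ ↩ a ⟦ r ⟧ʳ ⟦ s ⟧
      ⟦⟧ʳ-graftR a leaf      s = ≈ᴹ-refl
      ⟦⟧ʳ-graftR a (sub y t) s =
        ≈ᴹ-trans (↩-cong (a ↓ y) ≈ᴹ-refl (⟦⟧-graftR a t s)) (≈ᴹ-sym (rel₂ a y e ⟦ t ⟧ ⟦ s ⟧))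

    mutual
      ⟦⟧-graftL : ∀ a s t → ⟦ graftL a s t ⟧ ≈ᴹ ↪ a ⟦ s ⟧ ⟦ t ⟧
      ⟦⟧-graftL a s (node l r) = ⟦⟧ˡ-graftL a s l ⟦ r ⟧ʳ

      ⟦⟧ˡ-graftL : ∀ a s l x → ⟦ graftLᶜ a s l ⟧ˡ x ≈ᴹ ↪ a ⟦ s ⟧ (⟦ l ⟧ˡ x)
      ⟦⟧ˡ-graftL a s leaf      x = ≈ᴹ-refl
      ⟦⟧ˡ-graftL a s (sub b t) x =
        ≈ᴹ-trans (↪-cong (a ↓ b) (⟦⟧-graftL a s t) ≈ᴹ-refl) (rel₃ a b ⟦ s ⟧ ⟦ t ⟧ x)

    ↩-bilinear : ∀ a → IsBilinearOp (↩ a)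
    ↩-bilinear a = record
      { cong = ↩-cong a ; +-distribʳ = ↩-distribʳ a ; +-distribˡ = ↩-distribˡ a
      ; scaleˡ = ↩-scaleˡ a ; scaleʳ = ↩-scaleʳ a }

    ↪-bilinear : ∀ a → IsBilinearOp (↪ a)
    ↪-bilinear a = record
      { cong = ↪-cong a ; +-distribʳ = ↪-distribʳ a ; +-distribˡ = ↪-distribˡ a
      ; scaleˡ = ↪-scaleˡ a ; scaleʳ = ↪-scaleʳ a }

    extend⟦⟧-isMultHom : IsMultHom A (extend ⟦_⟧)
    extend⟦⟧-isMultHom = record
      { f-cong = λ {u} {v} → extend-cong ⟦_⟧ {u} {v}
      ; f-+    = extend-++ ⟦_⟧
      ; f-*ₗ   = extend-*ₗ ⟦_⟧
      ; f-↩    = λ a → extend-bilin module′ ⟦_⟧ (↩-bilinear a) (⟦⟧-graftR a)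
      ; f-↪    = λ a → extend-bilin module′ ⟦_⟧ (↪-bilinear a) (⟦⟧-graftL a)
      }

    module _ {g : F → Carrierᴹ} (g-hom : IsMultHom A g) (g-gen : g gen ≈ᴹ e) where
      open IsMultHom g-hom

      g-linear : IsLinear module′ g
      g-linear = record { cong = f-cong ; +-homo = f-+ ; *ₗ-homo = f-*ₗ }

      mutual
        g-basis : ∀ t → g (basis t) ≈ᴹ ⟦ t ⟧
        g-basis (node leaf r)      = g-basisʳ r
        g-basis (node (sub a t) r) = begin
          g (basis (graftL a t (node leaf r)))
            ≈⟨ f-cong (λ w → sym (bilin-basis (graftL a) t (node leaf r) w)) ⟩
          g (↪F a (basis t) (basis (node leaf r)))    ≈⟨ f-↪ a (basis t) (basis (node leaf r)) ⟩
          ↪ a (g (basis t)) (g (basis (node leaf r))) ≈⟨ ↪-cong a (g-basis t) (g-basisʳ r) ⟩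
          ↪ a ⟦ t ⟧ ⟦ r ⟧ʳ                            ∎

        g-basisʳ : ∀ r → g (basis (node leaf r)) ≈ᴹ ⟦ r ⟧ʳ
        g-basisʳ leaf      = g-gen
        g-basisʳ (sub a t) = begin
          g (basis (graftR a Y t))        ≈⟨ f-cong (λ w → sym (bilin-basis (graftR a) Y t w)) ⟩
          g (↩F a gen (basis t))          ≈⟨ f-↩ a gen (basis t) ⟩
          ↩ a (g gen) (g (basis t))       ≈⟨ ↩-cong a g-gen (g-basis t) ⟩
          ↩ a e ⟦ t ⟧                     ∎

      unique-extension : ∀ u → g u ≈ᴹ extend ⟦_⟧ u
      unique-extension = linear-unique g-linear (extend-linear ⟦_⟧)
        (λ t → ≈ᴹ-trans (g-basis t) (≈ᴹ-sym (extend-basis ⟦_⟧ t)))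

    universal-property : Σ (F → Carrierᴹ) λ f →
      IsMultHom A f × f gen ≈ᴹ e × ((g : F → Carrierᴹ) → IsMultHom A g → g gen ≈ᴹ e → ∀ u → g u ≈ᴹ f u)
    universal-property =
      extend ⟦_⟧ , extend⟦⟧-isMultHom , extend-basis ⟦_⟧ Y , λ g g-hom g-gen → unique-extension g-hom g-gen

theorem4p1p6 : ∀ {c ℓ m ℓm} (K : Field c ℓ) → CharacteristicZero K → (γ : ℕ) →
    let R = Field.commutativeRing K
        open FreeConstruction R γ
    in IsModule R _≈F_ _+F_ 0F -F_ _*ₗF_ _*ᵣF_
       × IsMultiplicial R _≈F_ _+F_ _*ₗF_ γ ↩F ↪F
       × ((A : MultiplicialAlgebra R γ m ℓm) (e : MultiplicialAlgebra.Carrierᴹ A) →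
            Σ (F → MultiplicialAlgebra.Carrierᴹ A) λ f →
              IsMultHom A f
              × MultiplicialAlgebra._≈ᴹ_ A (f gen) e
              × ((g : F → MultiplicialAlgebra.Carrierᴹ A) → IsMultHom A g →
                   MultiplicialAlgebra._≈ᴹ_ A (g gen) e →
                   ∀ u → MultiplicialAlgebra._≈ᴹ_ A (g u) (f u)))
theorem4p1p6 K _ γ = isModuleF R γ , isMultiplicialF R γ , universal-property R γ
  where R = Field.commutativeRing K
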